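{- For each $i\ge 6$, let $\alpha_i=\mathtt{a}$ if $i$ is even and $\alpha_i=\mathtt{b}$ if $i$ is odd, and let $\overline{\alpha_i}$ be the other letter. Then the set of minimal unique substrings of $F_i$ is $\{\alpha_i\,G_{i-3}\,\alpha_i,\ \overline{\alpha_i}\,G_{i-2}\,\overline{\alpha_i}\}$.
   Context: The Fibonacci morphism is $\varphi(\mathtt{a})=\mathtt{ab}$, $\varphi(\mathtt{b})=\mathtt{a}$; $F_i=\varphi^{i-1}(\mathtt{b})$ for $i\ge1$ (so $F_1=\mathtt{b}$, $F_2=\mathtt{a}$, $F_i=F_{i-1}F_{i-2}$), $f_i=|F_i|$, and $G_i=F_i[1..f_i-2]$ for $i\ge3$. A minimal unique substring (MUS) of $w$ is a substring $u$ occurring exactly once in $w$, say at $[i,j]$, such that both $w[i+1..j]$ and $w[i..j-1]$ occur at least twice in $w$ (the empty word is considered to occur $|w|+1$ times). -}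

module Defs where

open import Data.Nat using (ℕ; zero; suc; _+_; _∸_; _≤_)
open import Data.List using (List; []; _∷_; _++_; length; take; drop; concatMap; filter; upTo)
open import Data.List.Properties using (≡-dec)
open import Relation.Binary.PropositionalEquality using (_≡_)
open import Relation.Nullary using (Dec; yes; no)
open import Data.Product using (_×_)

data Letter : Set where
  a b : Letter

_≟L_ : (x y : Letter) → Dec (x ≡ y)
a ≟L a = yes _≡_.refl
a ≟L b = no (λ ())
b ≟L a = no (λ ())
b ≟L b = yes _≡_.refl

Word : Set
Word = List Letter

φ : Word → Word
φ = concatMap (λ { a → a ∷ b ∷ [] ; b → a ∷ [] })

φ^ : ℕ → Word → Word
φ^ zero w = w
φ^ (suc n) w = φ (φ^ n w)

F : ℕ → Word
F i = φ^ (i ∸ 1) (b ∷ [])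

G : ℕ → Word
G i = take (length (F i) ∸ 2) (F i)

-- number of occurrences of u in w: the number of (0-based) positions p,
-- 0 ≤ p ≤ |w| - |u|, with w[p .. p+|u|-1] = u.  For u = [] this is |w|+1.
occ : Word → Word → ℕ
occ w u = length (filter (λ p → ≡-dec _≟L_ (take (length u) (drop p w)) u)
                         (upTo (suc (length w) ∸ length u)))

dropFirst : Word → Word
dropFirst = drop 1

dropLast : Word → Word
dropLast u = take (length u ∸ 1) u

MUS : Word → Word → Set
MUS w u = occ w u ≡ 1 × 2 ≤ occ w (dropFirst u) × 2 ≤ occ w (dropLast u)

α : ℕ → Letter
α zero = a
α (suc zero) = b
α (suc (suc n)) = α n

bar : Letter → Letter
bar a = b
bar b = a

-- Write W = φ w. As φ a and φ b both begin with a and every b of W is preceded by an a,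
-- occurrences transfer along φ: φ (v ∷ʳ a) occurs in W as often as v ∷ʳ a in w, and φ v ∷ʳ a as
-- often as v is followed by some letter in w, i.e. count v w, minus one if v is a suffix of w.
-- Desubstituting a MUS of W with these counts shows that the MUSs of W are exactly the words
-- bar c ∷ (φ g ∷ʳ a) ∷ʳ bar c for the MUSs c ∷ g ∷ʳ c of w, provided every MUS of w begins and
-- ends with the same letter, no MUS of w is a suffix of w, and no suffix of w occurs exactly twice.
-- For w = F (6 + n) = F (5 + n) ++ F (4 + n) a suffix either lies in the last F (4 + n), which
-- occurs three times, or contains the unique MUS bar (α n) ∷ G (4 + n) ∷ʳ bar (α n). Since
-- F (7 + n) = φ (F (6 + n)) and G (4 + n) = φ (G (3 + n)) ∷ʳ a, induction from a direct check of
-- F 6 = abaababa proves the theorem.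

module Submission where

open import Defs
import Algebra.Properties.CommutativeSemigroup
open import Data.Bool using (true; false; if_then_else_)
open import Data.Empty using (⊥-elim)
open import Data.List
  using (List; []; _∷_; _++_; [_]; _∷ʳ_; length; take; drop; filter; upTo; applyUpTo; concatMap; inits; tails)
open import Data.List.Membership.Propositional using (_∈_)
open import Data.List.Membership.Propositional.Properties using (∈-map⁺; ∈-++⁺ˡ; ∈-++⁺ʳ)
open import Data.List.Properties
  using (≡-dec; ++-assoc; ++-identityʳ; ++-cancelʳ; ∷ʳ-++; ∷-injective; ∷ʳ-injective; ∷ʳ-injectiveʳ;
         length-++; length-upTo; filter-all)
import Data.List.Relation.Unary.All as All
open import Data.List.Relation.Unary.Any using (here; there)
open import Data.List.Reverse using (reverseView; []; _∶_∶ʳ_)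
open import Data.Nat using (ℕ; zero; suc; _+_; _∸_; _≤_; _<_; s≤s; z≤n; _≟_; _≤?_)
open import Data.Nat.Properties
open import Data.Product using (∃; ∃₂; _×_; _,_; proj₁; proj₂)
open import Data.Sum using (_⊎_; inj₁; inj₂)
open import Data.Unit using (tt)
open import Function using (_∘_)
open import Function.Bundles using (_⇔_; mk⇔; module Equivalence)
open import Function.Properties.Equivalence using () renaming (trans to ⇔-trans)
open import Relation.Binary.PropositionalEquality hiding ([_])
open import Relation.Nullary using (¬_; Dec; yes; no; does)
open import Relation.Nullary.Decidable using (toWitness; _×-dec_; _⊎-dec_; _→-dec_)
open import Relation.Unary using (Pred; Decidable)

open Algebra.Properties.CommutativeSemigroup +-commutativeSemigroup using (interchange)

take-length-++ : ∀ (x y : Word) → take (length x) (x ++ y) ≡ x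
take-length-++ []      y = refl
take-length-++ (c ∷ x) y = cong (c ∷_) (take-length-++ x y)

take-∸-length : ∀ (x y : Word) → take (length (x ++ y) ∸ length y) (x ++ y) ≡ x
take-∸-length x y = begin
  take (length (x ++ y) ∸ length y) (x ++ y)         ≡⟨ cong (λ n → take (n ∸ length y) (x ++ y)) (length-++ x) ⟩
  take (length x + length y ∸ length y) (x ++ y)     ≡⟨ cong (λ n → take n (x ++ y)) (m+n∸n≡m (length x) (length y)) ⟩
  take (length x) (x ++ y)                           ≡⟨ take-length-++ x y ⟩
  x                                                  ∎
  where open ≡-Reasoning

dropLast-∷ʳ : ∀ x c → dropLast (x ∷ʳ c) ≡ x
dropLast-∷ʳ x c = take-∸-length x [ c ]

suffix-of-++ : ∀ (A B p x : Word) → A ++ B ≡ p ++ x →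
  (∃ λ q → B ≡ q ++ x) ⊎ (∃₂ λ q l → x ≡ (q ∷ʳ l) ++ B × A ≡ (p ++ q) ∷ʳ l)
suffix-of-++ A       B []      x eq with reverseView A
... | []          = inj₁ ([] , eq)
... | A′ ∶ _ ∶ʳ l = inj₂ (A′ , l , sym eq , refl)
suffix-of-++ []      B (y ∷ p) x eq = inj₁ (y ∷ p , eq)
suffix-of-++ (c ∷ A) B (y ∷ p) x eq with refl , eq′ ← ∷-injective eq with suffix-of-++ A B p x eq′
... | inj₁ inB                     = inj₁ inB
... | inj₂ (q , l , x≡ , A≡pql)    = inj₂ (q , l , x≡ , cong (c ∷_) A≡pql)

prefixCount : Word → Word → ℕ
prefixCount []      _       = 1
prefixCount (_ ∷ _) []      = 0
prefixCount (a ∷ u) (a ∷ w) = prefixCount u w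
prefixCount (a ∷ u) (b ∷ w) = 0
prefixCount (b ∷ u) (a ∷ w) = 0
prefixCount (b ∷ u) (b ∷ w) = prefixCount u w

sumSuffixes : (Word → ℕ) → Word → ℕ
sumSuffixes f []      = f []
sumSuffixes f (y ∷ w) = f (y ∷ w) + sumSuffixes f w

count : Word → Word → ℕ
count u = sumSuffixes (prefixCount u)

eqCount : Word → Word → ℕ
eqCount u w = if does (≡-dec _≟L_ u w) then 1 else 0

suffixCount : Word → Word → ℕ
suffixCount u = sumSuffixes (eqCount u)

rightExtCount : Word → Word → ℕ
rightExtCount x w = count (x ∷ʳ a) w + count (x ∷ʳ b) w

sumSuffixes-cong : ∀ {f g} → (∀ s → f s ≡ g s) → ∀ w → sumSuffixes f w ≡ sumSuffixes g w
sumSuffixes-cong f≡g []      = f≡g []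
sumSuffixes-cong f≡g (y ∷ w) = cong₂ _+_ (f≡g (y ∷ w)) (sumSuffixes-cong f≡g w)

sumSuffixes-mono : ∀ {f g} → (∀ s → f s ≤ g s) → ∀ w → sumSuffixes f w ≤ sumSuffixes g w
sumSuffixes-mono f≤g []      = f≤g []
sumSuffixes-mono f≤g (y ∷ w) = +-mono-≤ (f≤g (y ∷ w)) (sumSuffixes-mono f≤g w)

sumSuffixes-+ : ∀ f g w → sumSuffixes (λ s → f s + g s) w ≡ sumSuffixes f w + sumSuffixes g w
sumSuffixes-+ f g []      = refl
sumSuffixes-+ f g (y ∷ w) = trans (cong (f (y ∷ w) + g (y ∷ w) +_) (sumSuffixes-+ f g w))
  (interchange (f (y ∷ w)) (g (y ∷ w)) (sumSuffixes f w) (sumSuffixes g w))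

prefixCount≤1 : ∀ u s → prefixCount u s ≤ 1
prefixCount≤1 []      _       = ≤-refl
prefixCount≤1 (_ ∷ _) []      = z≤n
prefixCount≤1 (a ∷ u) (a ∷ s) = prefixCount≤1 u s
prefixCount≤1 (a ∷ u) (b ∷ s) = z≤n
prefixCount≤1 (b ∷ u) (a ∷ s) = z≤n
prefixCount≤1 (b ∷ u) (b ∷ s) = prefixCount≤1 u s

prefixCount-∷ʳ : ∀ x s →
  prefixCount x s ≡ prefixCount (x ∷ʳ a) s + prefixCount (x ∷ʳ b) s + eqCount x s
prefixCount-∷ʳ []      []      = refl
prefixCount-∷ʳ []      (a ∷ s) = refl
prefixCount-∷ʳ []      (b ∷ s) = refl
prefixCount-∷ʳ (_ ∷ _) []      = refl
prefixCount-∷ʳ (a ∷ x) (a ∷ s) = prefixCount-∷ʳ x s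
prefixCount-∷ʳ (a ∷ x) (b ∷ s) = refl
prefixCount-∷ʳ (b ∷ x) (a ∷ s) = refl
prefixCount-∷ʳ (b ∷ x) (b ∷ s) = prefixCount-∷ʳ x s

count-∷ʳ : ∀ x w → count x w ≡ rightExtCount x w + suffixCount x w
count-∷ʳ x w = begin
  count x w
    ≡⟨ sumSuffixes-cong (prefixCount-∷ʳ x) w ⟩
  sumSuffixes (λ s → prefixCount (x ∷ʳ a) s + prefixCount (x ∷ʳ b) s + eqCount x s) w
    ≡⟨ sumSuffixes-+ _ (eqCount x) w ⟩
  sumSuffixes (λ s → prefixCount (x ∷ʳ a) s + prefixCount (x ∷ʳ b) s) w + suffixCount x w
    ≡⟨ cong (_+ suffixCount x w) (sumSuffixes-+ (prefixCount (x ∷ʳ a)) (prefixCount (x ∷ʳ b)) w) ⟩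
  rightExtCount x w + suffixCount x w ∎
  where open ≡-Reasoning

eqCount-long : ∀ x w → length w < length x → eqCount x w ≡ 0
eqCount-long x w lt with ≡-dec _≟L_ x w
... | yes refl = ⊥-elim (<-irrefl refl lt)
... | no  _    = refl

suffixCount-long : ∀ x w → length w < length x → suffixCount x w ≡ 0
suffixCount-long x []      lt = eqCount-long x [] lt
suffixCount-long x (y ∷ w) lt =
  cong₂ _+_ (eqCount-long x (y ∷ w) lt) (suffixCount-long x w (<-trans (n<1+n _) lt))

suffixCount-cases : ∀ x w → suffixCount x w ≡ 0 ⊎ (suffixCount x w ≡ 1 × ∃ λ p → w ≡ p ++ x)
suffixCount-cases x [] with ≡-dec _≟L_ x []
... | yes refl = inj₂ (refl , [] , refl)
... | no  _    = inj₁ refl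
suffixCount-cases x (y ∷ w) with ≡-dec _≟L_ x (y ∷ w)
... | yes refl = inj₂ (cong suc (suffixCount-long (y ∷ w) w (n<1+n _)) , [] , refl)
... | no  _ with suffixCount-cases x w
...   | inj₁ none             = inj₁ none
...   | inj₂ (one , p , w≡px) = inj₂ (one , y ∷ p , cong (y ∷_) w≡px)

count-∷ʳ-cases : ∀ x w →
  count x w ≡ rightExtCount x w ⊎ (count x w ≡ suc (rightExtCount x w) × ∃ λ p → w ≡ p ++ x)
count-∷ʳ-cases x w with suffixCount-cases x w
... | inj₁ none = inj₁ (trans (count-∷ʳ x w) (trans (cong (rightExtCount x w +_) none) (+-identityʳ _)))
... | inj₂ (one , suffix) =
  inj₂ (trans (count-∷ʳ x w) (trans (cong (rightExtCount x w +_) one) (+-comm _ 1)) , suffix)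

rightExtCount≤count : ∀ x w → rightExtCount x w ≤ count x w
rightExtCount≤count x w = ≤-trans (m≤m+n _ _) (≤-reflexive (sym (count-∷ʳ x w)))

count-[] : ∀ w → count [] w ≡ suc (length w)
count-[] []      = refl
count-[] (_ ∷ w) = cong suc (count-[] w)

count-a+count-b : ∀ w → count [ a ] w + count [ b ] w ≡ length w
count-a+count-b []      = refl
count-a+count-b (a ∷ w) = cong suc (count-a+count-b w)
count-a+count-b (b ∷ w) = trans (+-suc _ _) (cong suc (count-a+count-b w))

prefixCount-++ʳ-≤ : ∀ x q s → prefixCount (x ++ q) s ≤ prefixCount x s
prefixCount-++ʳ-≤ []      q s       = prefixCount≤1 q s
prefixCount-++ʳ-≤ (_ ∷ _) q []      = z≤n
prefixCount-++ʳ-≤ (a ∷ x) q (a ∷ s) = prefixCount-++ʳ-≤ x q s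
prefixCount-++ʳ-≤ (a ∷ x) q (b ∷ s) = z≤n
prefixCount-++ʳ-≤ (b ∷ x) q (a ∷ s) = z≤n
prefixCount-++ʳ-≤ (b ∷ x) q (b ∷ s) = prefixCount-++ʳ-≤ x q s

count-++ʳ-≤ : ∀ x q w → count (x ++ q) w ≤ count x w
count-++ʳ-≤ x q = sumSuffixes-mono (prefixCount-++ʳ-≤ x q)

prefixCount-∷-≤ : ∀ c x y s → prefixCount (c ∷ x) (y ∷ s) ≤ prefixCount x s
prefixCount-∷-≤ a x a s = ≤-refl
prefixCount-∷-≤ a x b s = z≤n
prefixCount-∷-≤ b x a s = z≤n
prefixCount-∷-≤ b x b s = ≤-refl

count-∷-≤-shift : ∀ c x y w → count (c ∷ x) (y ∷ w) ≤ count x w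
count-∷-≤-shift c x y []      = ≤-trans (≤-reflexive (+-identityʳ _)) (prefixCount-∷-≤ c x y [])
count-∷-≤-shift c x y (z ∷ w) = +-mono-≤ (prefixCount-∷-≤ c x y (z ∷ w)) (count-∷-≤-shift c x z w)

count-∷-≤ : ∀ c x w → count (c ∷ x) w ≤ count x w
count-∷-≤ c x []      = z≤n
count-∷-≤ c x (y ∷ w) = ≤-trans (count-∷-≤-shift c x y w) (m≤n+m _ _)

count-++ˡ-≤ : ∀ p x w → count (p ++ x) w ≤ count x w
count-++ˡ-≤ []      x w = ≤-refl
count-++ˡ-≤ (c ∷ p) x w = ≤-trans (count-∷-≤ c (p ++ x) w) (count-++ˡ-≤ p x w)

count-infix-≤ : ∀ p x q w → count (p ++ x ++ q) w ≤ count x w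
count-infix-≤ p x q w = ≤-trans (count-++ˡ-≤ p (x ++ q) w) (count-++ʳ-≤ x q w)

count-≤-++ : ∀ u p w → count u w ≤ count u (p ++ w)
count-≤-++ u []      w = ≤-refl
count-≤-++ u (y ∷ p) w = ≤-trans (count-≤-++ u p w) (m≤n+m _ _)

prefixCount-self : ∀ u r → prefixCount u (u ++ r) ≡ 1
prefixCount-self []      r = refl
prefixCount-self (a ∷ u) r = prefixCount-self u r
prefixCount-self (b ∷ u) r = prefixCount-self u r

prefixCount≤count : ∀ u w → prefixCount u w ≤ count u w
prefixCount≤count u []      = ≤-refl
prefixCount≤count u (y ∷ w) = m≤m+n _ _

count-self : ∀ u r → 1 ≤ count u (u ++ r)
count-self u r = ≤-trans (≤-reflexive (sym (prefixCount-self u r))) (prefixCount≤count u (u ++ r))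

-- Occurrences at 0, |A| and |A| + |E|; the middle one because E ++ A begins with A.
count-overlap : ∀ A E Y → A ≢ [] → E ≢ [] → E ++ A ≡ A ++ Y → 3 ≤ count A (A ++ E ++ A)
count-overlap []      _       _ A≢[] _    _  = ⊥-elim (A≢[] refl)
count-overlap (_ ∷ _) []      _ _    E≢[] _  = ⊥-elim (E≢[] refl)
count-overlap A@(_ ∷ t) (e ∷ E) Y _ _ EA≡AY = begin
  3                                  ≤⟨ s≤s (s≤s (count-self A [])) ⟩
  2 + count A (A ++ [])              ≡⟨ cong (λ z → 2 + count A z) (++-identityʳ A) ⟩
  2 + count A A                      ≤⟨ +-monoʳ-≤ 2 (count-≤-++ A E A) ⟩
  2 + count A (E ++ A)               ≡⟨ cong (λ k → suc k + count A (E ++ A)) A-at-|A| ⟨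
  suc (count A (e ∷ E ++ A))         ≤⟨ s≤s (count-≤-++ A t (e ∷ E ++ A)) ⟩
  suc (count A (t ++ e ∷ E ++ A))    ≡⟨ cong (_+ count A (t ++ e ∷ E ++ A)) (prefixCount-self A _) ⟨
  count A (A ++ e ∷ E ++ A)          ∎
  where
  open ≤-Reasoning
  A-at-|A| : prefixCount A (e ∷ E ++ A) ≡ 1
  A-at-|A| = trans (cong (prefixCount A) EA≡AY) (prefixCount-self A Y)

prefixCount-long : ∀ u w → length w < length u → prefixCount u w ≡ 0
prefixCount-long (_ ∷ _) []      _        = refl
prefixCount-long (a ∷ u) (a ∷ w) (s≤s lt) = prefixCount-long u w lt
prefixCount-long (a ∷ u) (b ∷ w) _        = refl
prefixCount-long (b ∷ u) (a ∷ w) _        = refl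
prefixCount-long (b ∷ u) (b ∷ w) (s≤s lt) = prefixCount-long u w lt

count-long : ∀ u w → length w < length u → count u w ≡ 0
count-long u []      lt = prefixCount-long u [] lt
count-long u (y ∷ w) lt =
  cong₂ _+_ (prefixCount-long u (y ∷ w) lt) (count-long u w (<-trans (n<1+n _) lt))

module _ {p} {P : Pred ℕ p} (P? : Decidable P) where

  length-filter-∷ : ∀ x xs →
    length (filter P? (x ∷ xs)) ≡ (if does (P? x) then 1 else 0) + length (filter P? xs)
  length-filter-∷ x xs with does (P? x)
  ... | true  = refl
  ... | false = refl

  length-filter-applyUpTo-suc : ∀ (f : ℕ → ℕ) n →
    length (filter P? (applyUpTo (suc ∘ f) n)) ≡ length (filter (P? ∘ suc) (applyUpTo f n))
  length-filter-applyUpTo-suc f zero    = refl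
  length-filter-applyUpTo-suc f (suc n) with does (P? (suc (f 0)))
  ... | true  = cong suc (length-filter-applyUpTo-suc (f ∘ suc) n)
  ... | false = length-filter-applyUpTo-suc (f ∘ suc) n

private
  occursAt? : (w u : Word) → Decidable (λ p → take (length u) (drop p w) ≡ u)
  occursAt? w u p = ≡-dec _≟L_ (take (length u) (drop p w)) u

  occursAt?-0 : ∀ u x → (if does (occursAt? x u 0) then 1 else 0) ≡ prefixCount u x
  occursAt?-0 []      _       = refl
  occursAt?-0 (_ ∷ _) []      = refl
  occursAt?-0 (a ∷ u) (a ∷ x) = occursAt?-0 u x
  occursAt?-0 (a ∷ u) (b ∷ x) = refl
  occursAt?-0 (b ∷ u) (a ∷ x) = refl
  occursAt?-0 (b ∷ u) (b ∷ x) = occursAt?-0 u x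

  hitsUpTo : Word → Word → ℕ → ℕ
  hitsUpTo w u k = length (filter (occursAt? w u) (upTo k))

occ≡count : ∀ w u → occ w u ≡ count u w
occ≡count w       []      = begin
  hitsUpTo w [] (suc (length w))
    ≡⟨ cong length (filter-all (occursAt? w []) {upTo (suc (length w))} (All.universal (λ _ → refl) _)) ⟩
  length (upTo (suc (length w)))
    ≡⟨ length-upTo _ ⟩
  suc (length w)
    ≡⟨ count-[] w ⟨
  count [] w ∎
  where open ≡-Reasoning
occ≡count []      (c ∷ u) = cong (hitsUpTo [] (c ∷ u)) (0∸n≡0 (length u))
occ≡count (y ∷ w) (c ∷ u) with length u ≤? length w
... | no u≰w = trans (cong (hitsUpTo (y ∷ w) (c ∷ u)) (m≤n⇒m∸n≡0 (≰⇒> u≰w)))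
                     (sym (count-long (c ∷ u) (y ∷ w) (s≤s (≰⇒> u≰w))))
... | yes u≤w = begin
  hitsUpTo (y ∷ w) (c ∷ u) (suc (length w) ∸ length u)
    ≡⟨ cong (hitsUpTo (y ∷ w) (c ∷ u)) (+-∸-assoc 1 u≤w) ⟩
  length (filter (occursAt? (y ∷ w) (c ∷ u)) (0 ∷ applyUpTo suc k))
    ≡⟨ length-filter-∷ (occursAt? (y ∷ w) (c ∷ u)) 0 _ ⟩
  _ + length (filter (occursAt? (y ∷ w) (c ∷ u)) (applyUpTo suc k))
    ≡⟨ cong₂ _+_ (occursAt?-0 (c ∷ u) (y ∷ w))
                 (length-filter-applyUpTo-suc (occursAt? (y ∷ w) (c ∷ u)) (λ p → p) k) ⟩
  prefixCount (c ∷ u) (y ∷ w) + occ w (c ∷ u)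
    ≡⟨ cong (prefixCount (c ∷ u) (y ∷ w) +_) (occ≡count w (c ∷ u)) ⟩
  count (c ∷ u) (y ∷ w) ∎
  where
  open ≡-Reasoning
  k : ℕ
  k = length w ∸ length u

MUS′ : Word → Word → Set
MUS′ w u = count u w ≡ 1 × 2 ≤ count (dropFirst u) w × 2 ≤ count (dropLast u) w

MUS⇔MUS′ : ∀ w u → MUS w u ⇔ MUS′ w u
MUS⇔MUS′ w u = mk⇔
  (λ (once , first , last) →
     trans (sym (occ≡count w u)) once ,
     subst (2 ≤_) (occ≡count w (dropFirst u)) first ,
     subst (2 ≤_) (occ≡count w (dropLast u)) last)
  (λ (once , first , last) →
     trans (occ≡count w u) once ,
     subst (2 ≤_) (sym (occ≡count w (dropFirst u))) first ,
     subst (2 ≤_) (sym (occ≡count w (dropLast u))) last)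

-- Counting through φ

φ-++ : ∀ x y → φ (x ++ y) ≡ φ x ++ φ y
φ-++ []      y = refl
φ-++ (a ∷ x) y = cong (λ t → a ∷ b ∷ t) (φ-++ x y)
φ-++ (b ∷ x) y = cong (a ∷_) (φ-++ x y)

φ-∷ʳa : ∀ x → φ (x ∷ʳ a) ≡ (φ x ∷ʳ a) ∷ʳ b
φ-∷ʳa x = trans (φ-++ x [ a ]) (sym (++-assoc (φ x) [ a ] [ b ]))

φ-∷ʳb : ∀ x → φ (x ∷ʳ b) ≡ φ x ∷ʳ a
φ-∷ʳb x = φ-++ x [ b ]

φ-≢[] : ∀ {x} → x ≢ [] → φ x ≢ []
φ-≢[] {[]}    x≢[] = ⊥-elim (x≢[] refl)
φ-≢[] {a ∷ _} _    ()
φ-≢[] {b ∷ _} _    ()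

prefixCount-b∷-φ : ∀ s w → prefixCount (b ∷ s) (φ w) ≡ 0
prefixCount-b∷-φ s []      = refl
prefixCount-b∷-φ s (a ∷ w) = refl
prefixCount-b∷-φ s (b ∷ w) = refl

-- Every b of φ w is preceded by an a.
count-b∷-φ : ∀ s w → count (b ∷ s) (φ w) ≡ count (a ∷ b ∷ s) (φ w)
count-b∷-φ s []      = refl
count-b∷-φ s (a ∷ w) = cong (prefixCount s (φ w) +_) (count-b∷-φ s w)
count-b∷-φ s (b ∷ w) =
  trans (count-b∷-φ s w) (cong (_+ count (a ∷ b ∷ s) (φ w)) (sym (prefixCount-b∷-φ s w)))

count-bb-φ : ∀ s w → count (b ∷ b ∷ s) (φ w) ≡ 0
count-bb-φ s []      = refl
count-bb-φ s (a ∷ w) =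
  trans (cong (_+ count (b ∷ b ∷ s) (φ w)) (prefixCount-b∷-φ s w)) (count-bb-φ s w)
count-bb-φ s (b ∷ w) = count-bb-φ s w

count-bar∷φ : ∀ c y w → count (bar c ∷ φ y) (φ w) ≡ count (φ (c ∷ y)) (φ w)
count-bar∷φ a y w = count-b∷-φ (φ y) w
count-bar∷φ b y w = refl

count-bar∷φ∷ʳa : ∀ c y w → count (bar c ∷ φ y ∷ʳ a) (φ w) ≡ count (φ (c ∷ y) ∷ʳ a) (φ w)
count-bar∷φ∷ʳa a y w = count-b∷-φ (φ y ∷ʳ a) w
count-bar∷φ∷ʳa b y w = refl

sumSuffixes-φ : ∀ f → (∀ s → f (b ∷ s) ≡ 0) → ∀ w → sumSuffixes f (φ w) ≡ sumSuffixes (f ∘ φ) w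
sumSuffixes-φ f f[b∷]≡0 []      = refl
sumSuffixes-φ f f[b∷]≡0 (a ∷ w) =
  cong (f (φ (a ∷ w)) +_)
       (trans (cong (_+ sumSuffixes f (φ w)) (f[b∷]≡0 (φ w))) (sumSuffixes-φ f f[b∷]≡0 w))
sumSuffixes-φ f f[b∷]≡0 (b ∷ w) = cong (f (φ (b ∷ w)) +_) (sumSuffixes-φ f f[b∷]≡0 w)

prefixCount-φ++a∷-b∷ : ∀ v P x → prefixCount (φ v ++ a ∷ P) (b ∷ x) ≡ 0
prefixCount-φ++a∷-b∷ []      P x = refl
prefixCount-φ++a∷-b∷ (a ∷ v) P x = refl
prefixCount-φ++a∷-b∷ (b ∷ v) P x = refl

prefixCount-φ++ab : ∀ v s → prefixCount (φ v ++ a ∷ b ∷ []) (φ s) ≡ prefixCount (v ∷ʳ a) s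
prefixCount-φ++ab []      []      = refl
prefixCount-φ++ab []      (a ∷ s) = refl
prefixCount-φ++ab []      (b ∷ s) = prefixCount-b∷-φ [] s
prefixCount-φ++ab (a ∷ v) []      = refl
prefixCount-φ++ab (b ∷ v) []      = refl
prefixCount-φ++ab (a ∷ v) (a ∷ s) = prefixCount-φ++ab v s
prefixCount-φ++ab (a ∷ v) (b ∷ s) = prefixCount-b∷-φ _ s
prefixCount-φ++ab (b ∷ v) (a ∷ s) = prefixCount-φ++a∷-b∷ v (b ∷ []) (φ s)
prefixCount-φ++ab (b ∷ v) (b ∷ s) = prefixCount-φ++ab v s

prefixCount-φ∷ʳa : ∀ v s → prefixCount (φ v ∷ʳ a) (φ s) ≡ prefixCount (v ∷ʳ a) s + prefixCount (v ∷ʳ b) s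
prefixCount-φ∷ʳa []      []      = refl
prefixCount-φ∷ʳa []      (a ∷ s) = refl
prefixCount-φ∷ʳa []      (b ∷ s) = refl
prefixCount-φ∷ʳa (a ∷ v) []      = refl
prefixCount-φ∷ʳa (b ∷ v) []      = refl
prefixCount-φ∷ʳa (a ∷ v) (a ∷ s) = prefixCount-φ∷ʳa v s
prefixCount-φ∷ʳa (a ∷ v) (b ∷ s) = prefixCount-b∷-φ _ s
prefixCount-φ∷ʳa (b ∷ v) (a ∷ s) = prefixCount-φ++a∷-b∷ v [] (φ s)
prefixCount-φ∷ʳa (b ∷ v) (b ∷ s) = prefixCount-φ∷ʳa v s

count-φ-∷ʳa : ∀ v w → count (φ (v ∷ʳ a)) (φ w) ≡ count (v ∷ʳ a) w
count-φ-∷ʳa v w = begin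
  count (φ (v ∷ʳ a)) (φ w)              ≡⟨ cong (λ x → count x (φ w)) (φ-++ v [ a ]) ⟩
  count (φ v ++ a ∷ b ∷ []) (φ w)       ≡⟨ sumSuffixes-φ _ (prefixCount-φ++a∷-b∷ v (b ∷ [])) w ⟩
  sumSuffixes (prefixCount (φ v ++ a ∷ b ∷ []) ∘ φ) w
                                        ≡⟨ sumSuffixes-cong (prefixCount-φ++ab v) w ⟩
  count (v ∷ʳ a) w                      ∎
  where open ≡-Reasoning

count-φ∷ʳa : ∀ v w → count (φ v ∷ʳ a) (φ w) ≡ rightExtCount v w
count-φ∷ʳa v w = begin
  count (φ v ∷ʳ a) (φ w)                ≡⟨ sumSuffixes-φ _ (prefixCount-φ++a∷-b∷ v []) w ⟩
  sumSuffixes (prefixCount (φ v ∷ʳ a) ∘ φ) w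
                                        ≡⟨ sumSuffixes-cong (prefixCount-φ∷ʳa v) w ⟩
  sumSuffixes (λ s → prefixCount (v ∷ʳ a) s + prefixCount (v ∷ʳ b) s) w
                                        ≡⟨ sumSuffixes-+ (prefixCount (v ∷ʳ a)) (prefixCount (v ∷ʳ b)) w ⟩
  rightExtCount v w                     ∎
  where open ≡-Reasoning

-- Peel off the first letter: a ∷ φ y = φ (b ∷ y), a ∷ b ∷ φ y = φ (a ∷ y), and bb never occurs in φ w.
φ-factor : ∀ s w → 0 < count s (φ w) → ∃ λ y → s ≡ φ y ⊎ s ≡ b ∷ φ y
φ-factor []      w _ = [] , inj₁ refl
φ-factor (a ∷ s) w occurs with φ-factor s w (≤-trans occurs (count-∷-≤ a s (φ w)))
... | y , inj₁ refl = b ∷ y , inj₁ refl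
... | y , inj₂ refl = a ∷ y , inj₁ refl
φ-factor (b ∷ s) w occurs with φ-factor s w (≤-trans occurs (count-∷-≤ b s (φ w)))
... | y , inj₁ refl = y , inj₂ refl
... | y , inj₂ refl = ⊥-elim (<-irrefl (sym (count-bb-φ (φ y) w)) occurs)

count-[]≡1 : ∀ w → count [] w ≡ 1 → w ≡ []
count-[]≡1 []      _    = refl
count-[]≡1 (_ ∷ w) once = ⊥-elim (0≢1+n (trans (sym (suc-injective once)) (count-[] w)))

repeated-φ-image-ends-in-b : ∀ z w → count z w ≡ 1 → 2 ≤ count (φ z) (φ w) →
  ∃ λ Y → z ≡ Y ∷ʳ b × 2 ≤ count Y w
repeated-φ-image-ends-in-b z w once twice with reverseView z
... | [] with refl ← count-[]≡1 w once = ⊥-elim (<-irrefl refl twice)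
... | Y ∶ _ ∶ʳ a = ⊥-elim (<-irrefl (sym once) (≤-trans twice (≤-reflexive (count-φ-∷ʳa Y w))))
... | Y ∶ _ ∶ʳ b = Y , refl , (begin
  2                         ≤⟨ twice ⟩
  count (φ (Y ∷ʳ b)) (φ w)  ≡⟨ cong (λ x → count x (φ w)) (φ-∷ʳb Y) ⟩
  count (φ Y ∷ʳ a) (φ w)    ≡⟨ count-φ∷ʳa Y w ⟩
  rightExtCount Y w         ≤⟨ rightExtCount≤count Y w ⟩
  count Y w                 ∎)
  where open ≤-Reasoning

-- Minimal unique substrings of φ w

Bordered : Word → Set
Bordered u = ∃₂ λ c g → u ≡ c ∷ g ∷ʳ c

¬Bordered-single : ∀ c → ¬ Bordered [ c ]
¬Bordered-single c (_ , []    , ())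
¬Bordered-single c (_ , _ ∷ _ , ())

bordered-∷ : ∀ {d y} → Bordered (d ∷ y) → ∃ λ g → y ≡ g ∷ʳ d
bordered-∷ (_ , g , eq) with ∷-injective eq
... | refl , y≡gd = g , y≡gd

-- c ∷ g ∷ʳ c ↦ bar c ∷ (φ g ∷ʳ a) ∷ʳ bar c; the value on [] is junk.
musImage : Word → Word
musImage []      = []
musImage (c ∷ y) = bar c ∷ (φ (dropLast y) ∷ʳ a) ∷ʳ bar c

musImage-bordered : ∀ c g → musImage (c ∷ g ∷ʳ c) ≡ bar c ∷ (φ g ∷ʳ a) ∷ʳ bar c
musImage-bordered c g = cong (λ x → bar c ∷ (φ x ∷ʳ a) ∷ʳ bar c) (dropLast-∷ʳ g c)

module MUS-φ (w : Word)
  (MUS-bordered : ∀ u → MUS′ w u → Bordered u)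
  (suffix-not-twice : ∀ p x → w ≡ p ++ x → count x w ≢ 2)
  (MUS-not-suffix : ∀ p x → w ≡ p ++ x → ¬ MUS′ w x)
  (2≤|w| : 2 ≤ length w)
  where

  W : Word
  W = φ w

  rightExt≡1⇒count≡1 : ∀ x → rightExtCount x w ≡ 1 → count x w ≡ 1
  rightExt≡1⇒count≡1 x once with count-∷ʳ-cases x w
  ... | inj₁ eq                = trans eq once
  ... | inj₂ (eq , p , suffix) = ⊥-elim (suffix-not-twice p x suffix (trans eq (cong suc once)))

  2≤count⇒2≤rightExt : ∀ x → 2 ≤ count x w → 2 ≤ rightExtCount x w
  2≤count⇒2≤rightExt x twice with count-∷ʳ-cases x w
  ... | inj₁ eq                = subst (2 ≤_) eq twice
  ... | inj₂ (eq , p , suffix) =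
    ≤-pred (subst (2 <_) eq (≤∧≢⇒< twice (suffix-not-twice p x suffix ∘ sym)))

  MUS⇒rightExt≡1 : ∀ x → MUS′ w x → rightExtCount x w ≡ 1
  MUS⇒rightExt≡1 x m with count-∷ʳ-cases x w
  ... | inj₁ eq            = trans (sym eq) (proj₁ m)
  ... | inj₂ (_ , p , suffix) = ⊥-elim (MUS-not-suffix p x suffix m)

  countW : Word → ℕ
  countW x = count x W

  ¬MUS-single : ∀ c → ¬ MUS′ W [ bar c ]
  ¬MUS-single a (once , _) = ¬Bordered-single a (MUS-bordered [ a ] (a-once , twice-[] , twice-[]))
    where
    a-once : count [ a ] w ≡ 1
    a-once = trans (sym (count-φ-∷ʳa [] w)) (trans (sym (count-b∷-φ [] w)) once)
    twice-[] : 2 ≤ count [] w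
    twice-[] = ≤-trans 2≤|w| (≤-trans (n≤1+n _) (≤-reflexive (sym (count-[] w))))
  ¬MUS-single b (once , _) = <-irrefl (sym once) (begin-strict
    1                           <⟨ 2≤|w| ⟩
    length w                    ≡⟨ count-a+count-b w ⟨
    rightExtCount [] w          ≡⟨ count-φ∷ʳa [] w ⟨
    count [ a ] W               ∎)
    where open ≤-Reasoning

  MUS-preimage-∷ʳa : ∀ c y → MUS′ W (bar c ∷ φ (y ∷ʳ a)) → MUS′ w (c ∷ y ∷ʳ a)
  MUS-preimage-∷ʳa c y (once , first , last) = once′ , first′ , last′
    where
    open ≤-Reasoning
    once′ : count (c ∷ y ∷ʳ a) w ≡ 1
    once′ = trans (sym (count-φ-∷ʳa (c ∷ y) w)) (trans (sym (count-bar∷φ c (y ∷ʳ a) w)) once)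
    first′ : 2 ≤ count (y ∷ʳ a) w
    first′ = ≤-trans first (≤-reflexive (count-φ-∷ʳa y w))
    last′ : 2 ≤ count (dropLast (c ∷ y ∷ʳ a)) w
    last′ = begin
      2                                       ≤⟨ last ⟩
      countW (dropLast (bar c ∷ φ (y ∷ʳ a)))  ≡⟨ cong (countW ∘ dropLast ∘ (bar c ∷_)) (φ-∷ʳa y) ⟩
      countW (dropLast ((bar c ∷ φ y ∷ʳ a) ∷ʳ b))
                                              ≡⟨ cong countW (dropLast-∷ʳ (bar c ∷ φ y ∷ʳ a) b) ⟩
      countW (bar c ∷ φ y ∷ʳ a)               ≡⟨ count-bar∷φ∷ʳa c y w ⟩
      countW (φ (c ∷ y) ∷ʳ a)                 ≡⟨ count-φ∷ʳa (c ∷ y) w ⟩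
      rightExtCount (c ∷ y) w                 ≤⟨ rightExtCount≤count (c ∷ y) w ⟩
      count (c ∷ y) w                         ≡⟨ cong (λ x → count x w) (dropLast-∷ʳ (c ∷ y) a) ⟨
      count (dropLast (c ∷ y ∷ʳ a)) w         ∎

  MUS-preimage-∷ʳb : ∀ c y → MUS′ W (bar c ∷ φ (y ∷ʳ b)) → MUS′ w (c ∷ y) × ∃ λ Y → c ∷ y ≡ Y ∷ʳ b
  MUS-preimage-∷ʳb c y (once , first , last) = (once′ , first′ , last′) , Y , cy≡Yb
    where
    open ≤-Reasoning
    u≡ : bar c ∷ φ (y ∷ʳ b) ≡ bar c ∷ φ y ∷ʳ a
    u≡ = cong (bar c ∷_) (φ-∷ʳb y)
    once′ : count (c ∷ y) w ≡ 1
    once′ = rightExt≡1⇒count≡1 (c ∷ y) (begin-equality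
      rightExtCount (c ∷ y) w     ≡⟨ count-φ∷ʳa (c ∷ y) w ⟨
      countW (φ (c ∷ y) ∷ʳ a)     ≡⟨ count-bar∷φ∷ʳa c y w ⟨
      countW (bar c ∷ φ y ∷ʳ a)   ≡⟨ cong countW u≡ ⟨
      countW (bar c ∷ φ (y ∷ʳ b)) ≡⟨ once ⟩
      1                           ∎)
    first′ : 2 ≤ count y w
    first′ = begin
      2                           ≤⟨ first ⟩
      countW (φ (y ∷ʳ b))         ≡⟨ cong countW (φ-∷ʳb y) ⟩
      countW (φ y ∷ʳ a)           ≡⟨ count-φ∷ʳa y w ⟩
      rightExtCount y w           ≤⟨ rightExtCount≤count y w ⟩
      count y w                   ∎
    image-twice : 2 ≤ countW (φ (c ∷ y))
    image-twice = begin
      2                                    ≤⟨ last ⟩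
      countW (dropLast (bar c ∷ φ (y ∷ʳ b))) ≡⟨ cong (countW ∘ dropLast) u≡ ⟩
      countW (dropLast (bar c ∷ φ y ∷ʳ a)) ≡⟨ cong countW (dropLast-∷ʳ (bar c ∷ φ y) a) ⟩
      countW (bar c ∷ φ y)                 ≡⟨ count-bar∷φ c y w ⟩
      countW (φ (c ∷ y))                   ∎
    ends-in-b : ∃ λ Y → c ∷ y ≡ Y ∷ʳ b × 2 ≤ count Y w
    ends-in-b = repeated-φ-image-ends-in-b (c ∷ y) w once′ image-twice
    Y : Word
    Y = proj₁ ends-in-b
    cy≡Yb : c ∷ y ≡ Y ∷ʳ b
    cy≡Yb = proj₁ (proj₂ ends-in-b)
    last′ : 2 ≤ count (dropLast (c ∷ y)) w
    last′ = subst (λ x → 2 ≤ count x w) (sym (trans (cong dropLast cy≡Yb) (dropLast-∷ʳ Y b)))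
                  (proj₂ (proj₂ ends-in-b))

  MUS-bar∷φ : ∀ c y → MUS′ W (bar c ∷ φ y) → ∃ λ v → MUS′ w v × bar c ∷ φ y ≡ musImage v
  MUS-bar∷φ c y m with reverseView y
  ... | [] = ⊥-elim (¬MUS-single c m)
  ... | y′ ∶ _ ∶ʳ a with MUS-preimage-∷ʳa c y′ m
  ...   | mus with bordered-∷ (MUS-bordered _ mus)
  ...     | g , eq with ∷ʳ-injective y′ g eq
  ...       | refl , refl =
    a ∷ y′ ∷ʳ a , mus , trans (cong (b ∷_) (φ-∷ʳa y′)) (sym (musImage-bordered a y′))
  MUS-bar∷φ c y m | y′ ∶ _ ∶ʳ b with MUS-preimage-∷ʳb c y′ m
  ... | mus , Y , cy≡Yb with bordered-∷ (MUS-bordered _ mus)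
  ...   | g , refl with ∷ʳ-injectiveʳ (c ∷ g) Y cy≡Yb
  ...     | refl =
    b ∷ g ∷ʳ b , mus , trans (cong (a ∷_) (trans (φ-∷ʳb (g ∷ʳ b)) (cong (_∷ʳ a) (φ-∷ʳb g))))
                             (sym (musImage-bordered b g))

  MUS-φ-image : ∀ u → MUS′ W u → ∃ λ v → MUS′ w v × u ≡ musImage v
  MUS-φ-image u m@(once , first , _) with φ-factor u w (≤-reflexive (sym once))
  ... | y       , inj₂ refl = MUS-bar∷φ a y m
  ... | b ∷ y   , inj₁ refl = MUS-bar∷φ b y m
  ... | []      , inj₁ refl = ⊥-elim (<-irrefl (sym once) first)
  ... | a ∷ y   , inj₁ refl = ⊥-elim (<-irrefl (sym once) (≤-trans first (≤-reflexive (count-b∷-φ (φ y) w))))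

  MUS-bordered-image : ∀ c g → MUS′ w (c ∷ g ∷ʳ c) → MUS′ W (bar c ∷ (φ g ∷ʳ a) ∷ʳ bar c)
  MUS-bordered-image a g (once , first , last) = once′ , first′ , last′
    where
    open ≤-Reasoning
    u≡ : b ∷ (φ g ∷ʳ a) ∷ʳ b ≡ b ∷ φ (g ∷ʳ a)
    u≡ = cong (b ∷_) (sym (φ-∷ʳa g))
    once′ : countW (b ∷ (φ g ∷ʳ a) ∷ʳ b) ≡ 1
    once′ = trans (cong countW u≡) (trans (count-bar∷φ a (g ∷ʳ a) w) (trans (count-φ-∷ʳa (a ∷ g) w) once))
    first′ : 2 ≤ countW ((φ g ∷ʳ a) ∷ʳ b)
    first′ = ≤-trans first (≤-reflexive (trans (sym (count-φ-∷ʳa g w)) (cong countW (φ-∷ʳa g))))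
    init-twice : 2 ≤ count (a ∷ g) w
    init-twice = subst (λ x → 2 ≤ count x w) (dropLast-∷ʳ (a ∷ g) a) last
    last′ : 2 ≤ countW (dropLast (b ∷ (φ g ∷ʳ a) ∷ʳ b))
    last′ = begin
      2                                      ≤⟨ 2≤count⇒2≤rightExt (a ∷ g) init-twice ⟩
      rightExtCount (a ∷ g) w                ≡⟨ count-φ∷ʳa (a ∷ g) w ⟨
      countW (φ (a ∷ g) ∷ʳ a)                ≡⟨ count-bar∷φ∷ʳa a g w ⟨
      countW (b ∷ φ g ∷ʳ a)                  ≡⟨ cong countW (dropLast-∷ʳ (b ∷ φ g ∷ʳ a) b) ⟨
      countW (dropLast (b ∷ (φ g ∷ʳ a) ∷ʳ b)) ∎
  MUS-bordered-image b g m@(_ , first , last) = once′ , first′ , last′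
    where
    open ≤-Reasoning
    once′ : countW (a ∷ (φ g ∷ʳ a) ∷ʳ a) ≡ 1
    once′ = begin-equality
      countW (a ∷ (φ g ∷ʳ a) ∷ʳ a)   ≡⟨ cong (λ x → countW ((a ∷ x) ∷ʳ a)) (φ-∷ʳb g) ⟨
      countW (φ (b ∷ g ∷ʳ b) ∷ʳ a)   ≡⟨ count-φ∷ʳa (b ∷ g ∷ʳ b) w ⟩
      rightExtCount (b ∷ g ∷ʳ b) w   ≡⟨ MUS⇒rightExt≡1 (b ∷ g ∷ʳ b) m ⟩
      1                              ∎
    first′ : 2 ≤ countW ((φ g ∷ʳ a) ∷ʳ a)
    first′ = begin
      2                              ≤⟨ 2≤count⇒2≤rightExt (g ∷ʳ b) first ⟩
      rightExtCount (g ∷ʳ b) w       ≡⟨ count-φ∷ʳa (g ∷ʳ b) w ⟨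
      countW (φ (g ∷ʳ b) ∷ʳ a)       ≡⟨ cong (λ x → countW (x ∷ʳ a)) (φ-∷ʳb g) ⟩
      countW ((φ g ∷ʳ a) ∷ʳ a)       ∎
    init-twice : 2 ≤ count (b ∷ g) w
    init-twice = subst (λ x → 2 ≤ count x w) (dropLast-∷ʳ (b ∷ g) b) last
    last′ : 2 ≤ countW (dropLast (a ∷ (φ g ∷ʳ a) ∷ʳ a))
    last′ = begin
      2                              ≤⟨ 2≤count⇒2≤rightExt (b ∷ g) init-twice ⟩
      rightExtCount (b ∷ g) w        ≡⟨ count-φ∷ʳa (b ∷ g) w ⟨
      countW (a ∷ φ g ∷ʳ a)          ≡⟨ cong countW (dropLast-∷ʳ (a ∷ φ g ∷ʳ a) a) ⟨
      countW (dropLast (a ∷ (φ g ∷ʳ a) ∷ʳ a)) ∎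

  MUS-φ⇔ : ∀ u → MUS′ W u ⇔ ∃ λ v → MUS′ w v × u ≡ musImage v
  MUS-φ⇔ u = mk⇔ (MUS-φ-image u) image-MUS
    where
    image-MUS : (∃ λ v → MUS′ w v × u ≡ musImage v) → MUS′ W u
    image-MUS (v , m , refl) with MUS-bordered v m
    ... | c , g , refl = subst (MUS′ W) (sym (musImage-bordered c g)) (MUS-bordered-image c g m)

-- Fibonacci words

φ^-++ : ∀ n x y → φ^ n (x ++ y) ≡ φ^ n x ++ φ^ n y
φ^-++ zero    x y = refl
φ^-++ (suc n) x y = trans (cong φ (φ^-++ n x y)) (φ-++ (φ^ n x) (φ^ n y))

φ^-suc : ∀ n w → φ^ (suc n) w ≡ φ^ n (φ w)
φ^-suc zero    w = refl
φ^-suc (suc n) w = cong φ (φ^-suc n w)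

F-rec : ∀ n → F (3 + n) ≡ F (2 + n) ++ F (1 + n)
F-rec n = begin
  φ^ (2 + n) [ b ]             ≡⟨ φ^-suc (1 + n) [ b ] ⟩
  φ^ (1 + n) [ a ]             ≡⟨ φ^-suc n [ a ] ⟩
  φ^ n (a ∷ b ∷ [])            ≡⟨ φ^-++ n [ a ] [ b ] ⟩
  φ^ n [ a ] ++ φ^ n [ b ]     ≡⟨ cong (_++ φ^ n [ b ]) (φ^-suc n [ b ]) ⟨
  F (2 + n) ++ F (1 + n)       ∎
  where open ≡-Reasoning

F-≢[] : ∀ n → F (suc n) ≢ []
F-≢[] zero    ()
F-≢[] (suc n) = φ-≢[] (F-≢[] n)

α-suc : ∀ n → α (suc n) ≡ bar (α n)
α-suc zero          = refl
α-suc (suc zero)    = refl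
α-suc (suc (suc n)) = α-suc n

bar-involutive : ∀ c → bar (bar c) ≡ c
bar-involutive a = refl
bar-involutive b = refl

F-ends : ∀ n → ∃ λ H → F (3 + n) ≡ H ++ α n ∷ bar (α n) ∷ []
F-ends zero          = [] , refl
F-ends (suc zero)    = a ∷ [] , refl
F-ends (suc (suc n)) with H , F≡H++ ← F-ends n =
  F (4 + n) ++ H , trans (F-rec (2 + n)) (trans (cong (F (4 + n) ++_) F≡H++) (sym (++-assoc (F (4 + n)) H _)))

F-last : ∀ n → F (3 + n) ≡ G (3 + n) ++ α n ∷ bar (α n) ∷ []
F-last n with H , F≡H++ ← F-ends n = trans F≡H++ (cong (_++ _) (sym G≡H))
  where
  G≡H : G (3 + n) ≡ H
  G≡H = trans (cong (λ x → take (length x ∸ 2) x) F≡H++) (take-∸-length H (α n ∷ bar (α n) ∷ []))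

F-last′ : ∀ n → F (4 + n) ≡ G (4 + n) ++ bar (α n) ∷ α n ∷ []
F-last′ n = begin
  F (4 + n)                                          ≡⟨ F-last (suc n) ⟩
  G (4 + n) ++ α (suc n) ∷ bar (α (suc n)) ∷ []      ≡⟨ cong (λ c → G (4 + n) ++ c ∷ bar c ∷ []) (α-suc n) ⟩
  G (4 + n) ++ bar (α n) ∷ bar (bar (α n)) ∷ []      ≡⟨ cong (λ c → G (4 + n) ++ bar (α n) ∷ c ∷ []) (bar-involutive _) ⟩
  G (4 + n) ++ bar (α n) ∷ α n ∷ []                  ∎
  where open ≡-Reasoning

φ-two-letters : ∀ c → φ (c ∷ bar c ∷ []) ≡ a ∷ bar c ∷ c ∷ []
φ-two-letters a = refl
φ-two-letters b = refl

G-rec : ∀ n → G (4 + n) ≡ φ (G (3 + n)) ∷ʳ a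
G-rec n = ++-cancelʳ (bar (α n) ∷ α n ∷ []) (G (4 + n)) (φ (G (3 + n)) ∷ʳ a) (begin
  G (4 + n) ++ bar (α n) ∷ α n ∷ []                    ≡⟨ F-last′ n ⟨
  φ (F (3 + n))                                        ≡⟨ cong φ (F-last n) ⟩
  φ (G (3 + n) ++ α n ∷ bar (α n) ∷ [])                ≡⟨ φ-++ (G (3 + n)) _ ⟩
  φ (G (3 + n)) ++ φ (α n ∷ bar (α n) ∷ [])            ≡⟨ cong (φ (G (3 + n)) ++_) (φ-two-letters (α n)) ⟩
  φ (G (3 + n)) ++ a ∷ bar (α n) ∷ α n ∷ []            ≡⟨ ∷ʳ-++ (φ (G (3 + n))) a _ ⟨
  (φ (G (3 + n)) ∷ʳ a) ++ bar (α n) ∷ α n ∷ []         ∎)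
  where open ≡-Reasoning

F-commute : ∀ n → F (3 + n) ++ F (4 + n) ≡ F (4 + n) ++ F (1 + n) ++ F (2 + n)
F-commute n = begin
  F (3 + n) ++ F (4 + n)                                ≡⟨ cong (F (3 + n) ++_) (F-rec (1 + n)) ⟩
  F (3 + n) ++ F (3 + n) ++ F (2 + n)                   ≡⟨ cong (λ x → F (3 + n) ++ x ++ F (2 + n)) (F-rec n) ⟩
  F (3 + n) ++ (F (2 + n) ++ F (1 + n)) ++ F (2 + n)    ≡⟨ cong (F (3 + n) ++_) (++-assoc (F (2 + n)) _ _) ⟩
  F (3 + n) ++ F (2 + n) ++ F (1 + n) ++ F (2 + n)      ≡⟨ ++-assoc (F (3 + n)) _ _ ⟨
  (F (3 + n) ++ F (2 + n)) ++ F (1 + n) ++ F (2 + n)    ≡⟨ cong (_++ F (1 + n) ++ F (2 + n)) (F-rec (1 + n)) ⟨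
  F (4 + n) ++ F (1 + n) ++ F (2 + n)                   ∎
  where open ≡-Reasoning

F-thrice : ∀ n → 3 ≤ count (F (4 + n)) (F (6 + n))
F-thrice n = subst (λ x → 3 ≤ count (F (4 + n)) x) (sym F≡AEA)
  (count-overlap (F (4 + n)) (F (3 + n)) _ (F-≢[] (3 + n)) (F-≢[] (2 + n)) (F-commute n))
  where
  F≡AEA : F (6 + n) ≡ F (4 + n) ++ F (3 + n) ++ F (4 + n)
  F≡AEA = trans (F-rec (3 + n)) (trans (cong (_++ F (4 + n)) (F-rec (2 + n))) (++-assoc (F (4 + n)) _ _))

F-suffix : ∀ n p x → F (6 + n) ≡ p ++ x →
  3 ≤ count x (F (6 + n)) ⊎ ∃ λ q → x ≡ q ++ bar (α n) ∷ F (4 + n)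
F-suffix n p x F≡px with suffix-of-++ (F (5 + n)) (F (4 + n)) p x (trans (sym (F-rec (3 + n))) F≡px)
... | inj₁ (q , F≡qx) = inj₁ (begin
  3                                 ≤⟨ F-thrice n ⟩
  count (F (4 + n)) (F (6 + n))     ≡⟨ cong (λ y → count y (F (6 + n))) F≡qx ⟩
  count (q ++ x) (F (6 + n))        ≤⟨ count-++ˡ-≤ q x (F (6 + n)) ⟩
  count x (F (6 + n))               ∎)
  where open ≤-Reasoning
... | inj₂ (q , l , x≡ , F≡pql) =
  inj₂ (q , trans x≡ (trans (∷ʳ-++ q l (F (4 + n))) (cong (λ c → q ++ c ∷ F (4 + n)) l≡)))
  where
  l≡ : l ≡ bar (α n)
  l≡ = ∷ʳ-injectiveʳ (p ++ q) (G (5 + n) ∷ʳ α n)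
         (trans (sym F≡pql) (trans (F-last (2 + n)) (sym (∷ʳ-++ (G (5 + n)) (α n) _))))

mus₁ mus₂ : ℕ → Word
mus₁ n = α n ∷ G (3 + n) ++ [ α n ]
mus₂ n = bar (α n) ∷ G (4 + n) ++ [ bar (α n) ]

musImage-G : ∀ c n → musImage (c ∷ G (3 + n) ∷ʳ c) ≡ bar c ∷ G (4 + n) ∷ʳ bar c
musImage-G c n = trans (musImage-bordered c (G (3 + n))) (cong (λ x → bar c ∷ x ∷ʳ bar c) (sym (G-rec n)))

musImage-mus₁ : ∀ n → musImage (mus₁ n) ≡ mus₁ (suc n)
musImage-mus₁ n = trans (musImage-G (α n) n) (cong (λ c → c ∷ G (4 + n) ∷ʳ c) (sym (α-suc n)))

musImage-mus₂ : ∀ n → musImage (mus₂ n) ≡ mus₂ (suc n)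
musImage-mus₂ n =
  trans (musImage-G (bar (α n)) (suc n)) (cong (λ c → bar c ∷ G (5 + n) ∷ʳ bar c) (sym (α-suc n)))

length-bordered : ∀ (c : Letter) g x y → length (c ∷ g ∷ʳ c) ≡ length (g ++ x ∷ y ∷ [])
length-bordered c []      x y = refl
length-bordered c (_ ∷ g) x y = cong suc (length-bordered c g x y)

length-mus≤ : ∀ n u → u ≡ mus₁ n ⊎ u ≡ mus₂ n → length u ≤ length (F (4 + n))
length-mus≤ n u (inj₁ refl) = begin
  length (mus₁ n)                ≡⟨ trans (length-bordered (α n) (G (3 + n)) _ _) (cong length (sym (F-last n))) ⟩
  length (F (3 + n))             ≤⟨ m≤m+n _ _ ⟩
  length (F (3 + n)) + length (F (2 + n)) ≡⟨ trans (cong length (F-rec (1 + n))) (length-++ (F (3 + n))) ⟨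
  length (F (4 + n))             ∎
  where open ≤-Reasoning
length-mus≤ n u (inj₂ refl) =
  ≤-reflexive (trans (length-bordered (bar (α n)) (G (4 + n)) _ _) (cong length (sym (F-last′ n))))

mus₂-∷ʳ : ∀ n → mus₂ n ∷ʳ α n ≡ bar (α n) ∷ F (4 + n)
mus₂-∷ʳ n = cong (bar (α n) ∷_) (trans (++-assoc (G (4 + n)) _ _) (sym (F-last′ n)))

2≤|F| : ∀ n → 2 ≤ length (F (3 + n))
2≤|F| n = subst (2 ≤_) (sym (trans (cong length (F-last n)) (length-++ (G (3 + n))))) (m≤n+m 2 _)

module F-hypotheses (n : ℕ) (IH : ∀ u → MUS′ (F (6 + n)) u ⇔ (u ≡ mus₁ n ⊎ u ≡ mus₂ n)) where
  open Equivalence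

  MUS-bordered : ∀ u → MUS′ (F (6 + n)) u → Bordered u
  MUS-bordered u m with to (IH u) m
  ... | inj₁ refl = α n , G (3 + n) , refl
  ... | inj₂ refl = bar (α n) , G (4 + n) , refl

  suffix-not-twice : ∀ p x → F (6 + n) ≡ p ++ x → count x (F (6 + n)) ≢ 2
  suffix-not-twice p x F≡px twice with F-suffix n p x F≡px
  ... | inj₁ thrice = <-irrefl (sym twice) thrice
  ... | inj₂ (q , refl) = <-irrefl refl (begin-strict
    1                                                      <⟨ ≤-reflexive (sym twice) ⟩
    count (q ++ bar (α n) ∷ F (4 + n)) (F (6 + n))         ≡⟨ cong (λ y → count (q ++ y) (F (6 + n))) (mus₂-∷ʳ n) ⟨
    count (q ++ mus₂ n ++ [ α n ]) (F (6 + n))             ≤⟨ count-infix-≤ q (mus₂ n) [ α n ] (F (6 + n)) ⟩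
    count (mus₂ n) (F (6 + n))                             ≡⟨ proj₁ (from (IH (mus₂ n)) (inj₂ refl)) ⟩
    1                                                      ∎)
    where open ≤-Reasoning

  MUS-not-suffix : ∀ p x → F (6 + n) ≡ p ++ x → ¬ MUS′ (F (6 + n)) x
  MUS-not-suffix p x F≡px m@(once , _) with F-suffix n p x F≡px
  ... | inj₁ thrice = <-irrefl (sym once) (≤-trans (s≤s (s≤s z≤n)) thrice)
  ... | inj₂ (q , refl) = <-irrefl refl (begin-strict
    length (F (4 + n))                                     <⟨ m≤n+m _ (length q) ⟩
    length q + suc (length (F (4 + n)))                    ≡⟨ length-++ q ⟨
    length (q ++ bar (α n) ∷ F (4 + n))                    ≤⟨ length-mus≤ n _ (to (IH (q ++ bar (α n) ∷ F (4 + n))) m) ⟩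
    length (F (4 + n))                                     ∎)
    where open ≤-Reasoning

factors : Word → List Word
factors w = concatMap inits (tails w)

prefix∈inits : ∀ u x → prefixCount u x ≢ 0 → u ∈ inits x
prefix∈inits []      _       _  = here refl
prefix∈inits (_ ∷ _) []      ≢0 = ⊥-elim (≢0 refl)
prefix∈inits (a ∷ u) (a ∷ x) ≢0 = there (∈-map⁺ (a ∷_) (prefix∈inits u x ≢0))
prefix∈inits (a ∷ u) (b ∷ x) ≢0 = ⊥-elim (≢0 refl)
prefix∈inits (b ∷ u) (a ∷ x) ≢0 = ⊥-elim (≢0 refl)
prefix∈inits (b ∷ u) (b ∷ x) ≢0 = there (∈-map⁺ (b ∷_) (prefix∈inits u x ≢0))

factor∈factors : ∀ u w → count u w ≢ 0 → u ∈ factors w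
factor∈factors u []      ≢0 = ∈-++⁺ˡ (prefix∈inits u [] ≢0)
factor∈factors u (y ∷ w) ≢0 with prefixCount u (y ∷ w) in eq
... | zero  = ∈-++⁺ʳ (inits (y ∷ w)) (factor∈factors u w ≢0)
... | suc _ = ∈-++⁺ˡ (prefix∈inits u (y ∷ w) (λ ≡0 → 0≢1+n (trans (sym ≡0) eq)))

MUS′? : ∀ w u → Dec (MUS′ w u)
MUS′? w u = (count u w ≟ 1) ×-dec (2 ≤? count (dropFirst u) w) ×-dec (2 ≤? count (dropLast u) w)

MUS-F6 : ∀ u → MUS′ (F 6) u ⇔ (u ≡ mus₁ 0 ⊎ u ≡ mus₂ 0)
MUS-F6 u = mk⇔ listed listed-MUS
  where
  Listed : Word → Set
  Listed v = MUS′ (F 6) v → v ≡ mus₁ 0 ⊎ v ≡ mus₂ 0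
  Listed? : ∀ v → Dec (Listed v)
  Listed? v = MUS′? (F 6) v →-dec (≡-dec _≟L_ v (mus₁ 0) ⊎-dec ≡-dec _≟L_ v (mus₂ 0))
  all-listed : All.All Listed (factors (F 6))
  all-listed = toWitness {a? = All.all? Listed? (factors (F 6))} tt
  listed : Listed u
  listed m = All.lookup all-listed (factor∈factors u (F 6) (λ ≡0 → 0≢1+n (trans (sym ≡0) (proj₁ m)))) m
  listed-MUS : u ≡ mus₁ 0 ⊎ u ≡ mus₂ 0 → MUS′ (F 6) u
  listed-MUS (inj₁ refl) = toWitness {a? = MUS′? (F 6) (mus₁ 0)} tt
  listed-MUS (inj₂ refl) = toWitness {a? = MUS′? (F 6) (mus₂ 0)} tt

image-of-pair : ∀ {P : Word → Set} {f : Word → Word} {v₁ v₂ u₁ u₂} →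
  (∀ v → P v ⇔ (v ≡ v₁ ⊎ v ≡ v₂)) → f v₁ ≡ u₁ → f v₂ ≡ u₂ →
  ∀ u → (∃ λ v → P v × u ≡ f v) ⇔ (u ≡ u₁ ⊎ u ≡ u₂)
image-of-pair {P = P} {f} {v₁} {v₂} {u₁} {u₂} P⇔ fv₁≡u₁ fv₂≡u₂ u = mk⇔ to′ from′
  where
  open Equivalence
  to′ : (∃ λ v → P v × u ≡ f v) → u ≡ u₁ ⊎ u ≡ u₂
  to′ (v , Pv , u≡fv) with to (P⇔ v) Pv
  ... | inj₁ refl = inj₁ (trans u≡fv fv₁≡u₁)
  ... | inj₂ refl = inj₂ (trans u≡fv fv₂≡u₂)
  from′ : u ≡ u₁ ⊎ u ≡ u₂ → ∃ λ v → P v × u ≡ f v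
  from′ (inj₁ u≡u₁) = v₁ , from (P⇔ v₁) (inj₁ refl) , trans u≡u₁ (sym fv₁≡u₁)
  from′ (inj₂ u≡u₂) = v₂ , from (P⇔ v₂) (inj₂ refl) , trans u≡u₂ (sym fv₂≡u₂)

MUS-F : ∀ n u → MUS′ (F (6 + n)) u ⇔ (u ≡ mus₁ n ⊎ u ≡ mus₂ n)
MUS-F zero    = MUS-F6
MUS-F (suc n) u = ⇔-trans (MUS-φ⇔ u) (image-of-pair (MUS-F n) (musImage-mus₁ n) (musImage-mus₂ n) u)
  where
  open F-hypotheses n (MUS-F n)
  open MUS-φ (F (6 + n)) MUS-bordered suffix-not-twice MUS-not-suffix (2≤|F| (3 + n))

theorem33 : ∀ (i : ℕ) → 6 ≤ i → ∀ (u : Word) →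
    MUS (F i) u ⇔ (u ≡ α i ∷ (G (i ∸ 3) ++ [ α i ]) ⊎ u ≡ bar (α i) ∷ (G (i ∸ 2) ++ [ bar (α i) ]))
theorem33 i 6≤i u with n , refl ← m≤n⇒∃[o]m+o≡n 6≤i = ⇔-trans (MUS⇔MUS′ (F (6 + n)) u) (MUS-F n u)
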